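{- A realizable set $S\subset\mathbb{Z}^n$ is uniquely realizable if and only if $E(G^*_W)=E(\widehat{G})$ for every realization $(G,W)$ of $S$.
   Context: All graphs are finite, simple and connected; $d$ is the shortest-path distance. For an ordered vertex subset $W=(\omega_1,\dots,\omega_n)$, $r(u\vert W)=(d(u,\omega_1),\dots,d(u,\omega_n))$; $W$ is resolving if $r(\cdot\vert W)$ is injective on $V(G)$. $(G,W)$ is a realization of $S\subset\mathbb{Z}^n$ if $W$ is a resolving set of $G$ and $S=\{r(u\vert W)\colon u\in V(G)\}$; $S$ is realizable if it has a realization. Two realizations $(G,W)$, $(G',W')$ of $S$ are equivalent if the map $f\colon V(G)\to V(G')$ determined by $r(u\vert W)=r(f(u)\vert W')$ is a graph isomorphism; $S$ is uniquely realizable if all its realizations are equivalent. For a realization $(G,W)$, $G^*_W$ is the graph with vertex set $S$ and edge set $\{xy\colon x=r(v\vert W),\ y=r(v'\vert W),\ vv'\in E(G)\}$. The canonical realization of a realizable $S$ is $(\widehat{G},\widehat{W})$ where $V(\widehat{G})=S$, $E(\widehat{G})=\{xy\colon x,y\in S,\ \max_i\vert y_i-x_i\vert=1\}$ and $\widehat{W}=\{x\in S\colon x_i=0\text{ for some } i\}$, ordered so that its $i$-th element is the unique $x\in S$ with $x_i=0$. -}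

module Defs where

open import Data.Nat using (ℕ; zero; suc; _≤_; _⊔_)
open import Data.Integer using (ℤ; +_; _-_; ∣_∣)
open import Data.Fin using (Fin)
open import Data.Vec using (Vec; lookup; zipWith; foldr)
open import Data.Bool using (Bool; true; false)
open import Data.Product using (Σ; ∃; ∃-syntax; _×_; _,_)
open import Relation.Binary.PropositionalEquality using (_≡_)
open import Function.Definitions using (Injective; Bijective)
open import Function.Bundles using (_⇔_)

record Graph : Set where
  field
    order : ℕ
    adj   : Fin order → Fin order → Bool
    sym   : ∀ u v → adj u v ≡ adj v u
    irrefl : ∀ u → adj u u ≡ false

open Graph public

data Walk (G : Graph) : Fin (order G) → Fin (order G) → ℕ → Set where
  here : ∀ {u} → Walk G u u 0
  step : ∀ {u v w k} → adj G u v ≡ true → Walk G v w k → Walk G u w (suc k)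

Connected : Graph → Set
Connected G = ∀ u v → ∃[ k ] Walk G u v k

Dist : (G : Graph) → Fin (order G) → Fin (order G) → ℕ → Set
Dist G u v k = Walk G u v k × (∀ j → Walk G u v j → k ≤ j)

Rep : ∀ {n} (G : Graph) → (Fin n → Fin (order G)) → Fin (order G) → Vec ℤ n → Set
Rep G W u x = ∀ i → Σ ℕ (λ k → Dist G u (W i) k × lookup x i ≡ + k)

Resolving : ∀ {n} (G : Graph) → (Fin n → Fin (order G)) → Set
Resolving G W = ∀ u v x → Rep G W u x → Rep G W v x → u ≡ v

-- (G , W) is a realization of S ⊂ ℤⁿ (W an ordered vertex subset, i.e. injective)
IsRealization : ∀ {n} → (Vec ℤ n → Set) → (G : Graph) → (Fin n → Fin (order G)) → Set
IsRealization S G W =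
  Connected G × Injective _≡_ _≡_ W × Resolving G W ×
  (∀ x → S x ⇔ (∃[ u ] Rep G W u x))

Realization : ∀ {n} → (Vec ℤ n → Set) → Set
Realization {n} S = Σ Graph (λ G → Σ (Fin n → Fin (order G)) (λ W → IsRealization S G W))

Realizable : ∀ {n} → (Vec ℤ n → Set) → Set
Realizable S = Realization S

Equivalent : ∀ {n} {S : Vec ℤ n → Set} → Realization S → Realization S → Set
Equivalent (G , W , _) (G' , W' , _) =
  Σ (Fin (order G) → Fin (order G')) λ f →
    (∀ u x → Rep G W u x → Rep G' W' (f u) x) ×
    Bijective _≡_ _≡_ f ×
    (∀ u v → adj G u v ≡ adj G' (f u) (f v))

UniquelyRealizable : ∀ {n} → (Vec ℤ n → Set) → Set
UniquelyRealizable S = (R R' : Realization S) → Equivalent R R'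

maxDiff : ∀ {n} → Vec ℤ n → Vec ℤ n → ℕ
maxDiff x y = foldr _ _⊔_ 0 (zipWith (λ a b → ∣ b - a ∣) x y)

EdgeStar : ∀ {n} (G : Graph) → (Fin n → Fin (order G)) → Vec ℤ n → Vec ℤ n → Set
EdgeStar G W x y = ∃[ v ] ∃[ v' ] (Rep G W v x × Rep G W v' y × adj G v v' ≡ true)

EdgeCanonical : ∀ {n} → (Vec ℤ n → Set) → Vec ℤ n → Vec ℤ n → Set
EdgeCanonical S x y = S x × S y × maxDiff x y ≡ 1

SameEdges : ∀ {n} {S : Vec ℤ n → Set} → Realization S → Set
SameEdges {S = S} (G , W , _) = ∀ x y → EdgeStar G W x y ⇔ EdgeCanonical S x y

-- An edge uv of a realization changes each distance to W by at most one, and r(u|W) ≠ r(v|W);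
-- so r(u|W) and r(v|W) are at Chebyshev distance 1, i.e. E(G*_W) ⊆ E(Ĝ) always. Conversely, if
-- r(u|W) and r(v|W) are at Chebyshev distance 1 and uv is not an edge, adding it changes no
-- distance to W (d(·,ω) stays 1-Lipschitz along the new edge), which yields a second realization
-- of S; the equivalence with the first must fix u and v, so uv was an edge after all. Finally, if
-- G*_W = Ĝ for all realizations, matching the vertices of two realizations with equal
-- representations is a bijection that preserves adjacency.
module Submission where

open import Defs
open import Data.Bool using (true; false; _∨_)
open import Data.Bool.Properties using (∨-zeroʳ; ⇔→≡) renaming (_≟_ to _≟ᵇ_)
open import Data.Fin using (Fin; _≟_)
open import Data.Fin.Properties using (any?)
open import Data.Integer using (ℤ; +_)
import Data.Integer as ℤ
import Data.Integer.Properties as ℤ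
open import Data.Nat using (ℕ; zero; suc; _≤_; _<_; _+_; z≤n; s≤s; ∣_-_∣)
open import Data.Nat.Induction using (<-wellFounded)
open import Data.Nat.Properties
  using (≤-reflexive; ≤-antisym; ≮⇒≥; n≤0⇒n≡0; n≢0⇒n>0; 1+n≢0; +-suc; +-comm; m≤m+n;
         +-monoʳ-≤; ⊔-lub; m⊔n≤o⇒m≤o; m⊔n≤o⇒n≤o; ∣-∣-comm; m≤n+∣m-n∣; anyUpTo?; module ≤-Reasoning)
open import Data.Product using (∃; ∃-syntax; _×_; _,_; proj₁; proj₂; map₁; map₂)
open import Data.Empty using (⊥)
open import Data.Sum using (_⊎_; inj₁; inj₂)
open import Data.Vec using (Vec; []; _∷_; lookup; tabulate)
open import Data.Vec.Properties using (lookup∘tabulate)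
open import Data.Vec.Relation.Binary.Pointwise.Extensional using (ext; Pointwise-≡⇒≡)
open import Function.Base using (_∘_)
open import Function.Bundles using (_⇔_; Equivalence; mk⇔)
open import Function.Consequences.Propositional
  using (inverseᵇ⇒bijective; strictlyInverseˡ⇒inverseˡ; strictlyInverseʳ⇒inverseʳ)
open import Function.Construct.Composition using (_⇔-∘_)
open import Function.Construct.Symmetry using (⇔-sym)
open import Induction.WellFounded using (Acc; acc)
open import Relation.Nullary using (Dec; yes; no; does)
open import Relation.Nullary.Decidable using (_×-dec_; _⊎-dec_; map′; dec-true; dec-false; does-⇔)
open import Relation.Unary using (Pred; Decidable)
open import Relation.Binary.PropositionalEquality
  using (_≡_; _≢_; refl; trans; cong; cong₂; subst; subst₂; module ≡-Reasoning)
import Relation.Binary.PropositionalEquality as ≡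

open Equivalence using (to; from)

least-witness : ∀ {p} {P : Pred ℕ p} → Decidable P → ∀ {k} → P k →
                ∃[ m ] P m × (∀ j → P j → m ≤ j)
least-witness {P = P} P? {k} Pk = go (<-wellFounded k) Pk
  where
  go : ∀ {k} → Acc _<_ k → P k → ∃[ m ] P m × (∀ j → P j → m ≤ j)
  go {k} (acc smaller) Pk with anyUpTo? P? k
  ... | yes (j , j<k , Pj) = go (smaller j<k) Pj
  ... | no ∄below = k , Pk , λ j Pj → ≮⇒≥ (λ j<k → ∄below (j , j<k , Pj))

m≤1+n⇒n≤1+m⇒∣m-n∣≤1 : ∀ {m n} → m ≤ suc n → n ≤ suc m → ∣ m - n ∣ ≤ 1
m≤1+n⇒n≤1+m⇒∣m-n∣≤1 {zero}  {zero}  _         _         = z≤n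
m≤1+n⇒n≤1+m⇒∣m-n∣≤1 {zero}  {suc n} _         n≤0       = n≤0
m≤1+n⇒n≤1+m⇒∣m-n∣≤1 {suc m} {zero}  m≤0       _         = m≤0
m≤1+n⇒n≤1+m⇒∣m-n∣≤1 {suc m} {suc n} (s≤s m≤) (s≤s n≤) = m≤1+n⇒n≤1+m⇒∣m-n∣≤1 m≤ n≤

∣m⊖n∣≡∣m-n∣ : ∀ m n → ℤ.∣ m ℤ.⊖ n ∣ ≡ ∣ m - n ∣
∣m⊖n∣≡∣m-n∣ zero    zero    = refl
∣m⊖n∣≡∣m-n∣ zero    (suc n) = refl
∣m⊖n∣≡∣m-n∣ (suc m) zero    = refl
∣m⊖n∣≡∣m-n∣ (suc m) (suc n) = trans (cong ℤ.∣_∣ (ℤ.[1+m]⊖[1+n]≡m⊖n m n)) (∣m⊖n∣≡∣m-n∣ m n)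

∣[+m]-[+n]∣≡∣m-n∣ : ∀ m n → ℤ.∣ + m ℤ.- + n ∣ ≡ ∣ m - n ∣
∣[+m]-[+n]∣≡∣m-n∣ m n = trans (cong ℤ.∣_∣ (ℤ.[+m]-[+n]≡m⊖n m n)) (∣m⊖n∣≡∣m-n∣ m n)

maxDiff≤⇔ : ∀ {n m} (x y : Vec ℤ n) →
            maxDiff x y ≤ m ⇔ (∀ i → ℤ.∣ lookup y i ℤ.- lookup x i ∣ ≤ m)
maxDiff≤⇔ []      []      = mk⇔ (λ _ ()) (λ _ → z≤n)
maxDiff≤⇔ {m = m} (a ∷ x) (b ∷ y) = mk⇔ bounded lub
  where
  Bounded : ∀ {n} → Vec ℤ n → Vec ℤ n → Set
  Bounded x y = ∀ i → ℤ.∣ lookup y i ℤ.- lookup x i ∣ ≤ m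
  bounded : maxDiff (a ∷ x) (b ∷ y) ≤ m → Bounded (a ∷ x) (b ∷ y)
  bounded h Fin.zero    = m⊔n≤o⇒m≤o _ _ h
  bounded h (Fin.suc i) = to (maxDiff≤⇔ x y) (m⊔n≤o⇒n≤o _ _ h) i
  lub : Bounded (a ∷ x) (b ∷ y) → maxDiff (a ∷ x) (b ∷ y) ≤ m
  lub h = ⊔-lub (h Fin.zero) (from (maxDiff≤⇔ x y) (h ∘ Fin.suc))

maxDiff≡0⇔≡ : ∀ {n} {x y : Vec ℤ n} → maxDiff x y ≡ 0 ⇔ x ≡ y
maxDiff≡0⇔≡ {x = x} {y} = mk⇔ equal (λ { refl → zero-on-diagonal })
  where
  equal : maxDiff x y ≡ 0 → x ≡ y
  equal h = Pointwise-≡⇒≡ (ext λ i → ≡.sym (ℤ.i-j≡0⇒i≡j _ _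
              (ℤ.∣i∣≡0⇒i≡0 (n≤0⇒n≡0 (to (maxDiff≤⇔ x y) (≤-reflexive h) i)))))
  zero-on-diagonal : maxDiff x x ≡ 0
  zero-on-diagonal = n≤0⇒n≡0 (from (maxDiff≤⇔ x x)
                       (λ i → ≤-reflexive (cong ℤ.∣_∣ (ℤ.+-inverseʳ (lookup x i)))))

module _ (G : Graph) where

  walk? : ∀ u w k → Dec (Walk G u w k)
  walk? u w zero    = map′ (λ { refl → here }) (λ { here → refl }) (u ≟ w)
  walk? u w (suc k) = map′ (λ (v , e , walk) → step e walk) (λ { (step e walk) → _ , e , walk })
                           (any? (λ v → (adj G u v ≟ᵇ true) ×-dec walk? v w k))

  walk⇒Dist : ∀ {u w k} → Walk G u w k → ∃ (Dist G u w)
  walk⇒Dist = least-witness (walk? _ _)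

  Dist-refl : ∀ {w} → Dist G w w 0
  Dist-refl = here , λ _ _ → z≤n

  Dist-unique : ∀ {u w k k′} → Dist G u w k → Dist G u w k′ → k ≡ k′
  Dist-unique (walk , minimal) (walk′ , minimal′) = ≤-antisym (minimal _ walk′) (minimal′ _ walk)

  DistClose : Fin (order G) → Fin (order G) → Fin (order G) → Set
  DistClose w u v = ∀ {k k′} → Dist G u w k → Dist G v w k′ → ∣ k - k′ ∣ ≤ 1

  adj⇒DistClose : ∀ {u v} w → adj G u v ≡ true → DistClose w u v
  adj⇒DistClose w e (walk , minimal) (walk′ , minimal′) = m≤1+n⇒n≤1+m⇒∣m-n∣≤1
    (minimal _ (step e walk′)) (minimal′ _ (step (trans (sym G _ _) e) walk))

  Lipschitz : (Fin (order G) → ℕ) → Set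
  Lipschitz f = ∀ {a b} → adj G a b ≡ true → ∣ f a - f b ∣ ≤ 1

  Lipschitz⇒≤+length : ∀ {f a w k} → Lipschitz f → Walk G a w k → f a ≤ f w + k
  Lipschitz⇒≤+length {f} {a} lip here = m≤m+n (f a) 0
  Lipschitz⇒≤+length {f} {a} {w} {suc k} lip (step {v = b} e walk) = begin
    f a                  ≤⟨ m≤n+∣m-n∣ (f a) (f b) ⟩
    f b + ∣ f a - f b ∣  ≤⟨ +-monoʳ-≤ (f b) (lip e) ⟩
    f b + 1              ≡⟨ +-comm (f b) 1 ⟩
    suc (f b)            ≤⟨ s≤s (Lipschitz⇒≤+length lip walk) ⟩
    suc (f w + k)        ≡⟨ +-suc (f w) k ⟨
    f w + suc k          ∎
    where open ≤-Reasoning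

  module _ {n} {W : Fin n → Fin (order G)} where

    Rep-lookup : ∀ {u x i k} → Rep G W u x → Dist G u (W i) k → lookup x i ≡ + k
    Rep-lookup {i = i} r d with r i
    ... | _ , d′ , eq = trans eq (cong +_ (Dist-unique d′ d))

    Rep-unique : ∀ {u x y} → Rep G W u x → Rep G W u y → x ≡ y
    Rep-unique {x = x} rx ry = Pointwise-≡⇒≡ (ext λ i →
      let (_ , d , eq) = ry i in trans (Rep-lookup {x = x} rx d) (≡.sym eq))

    Rep-maxDiff≤1⇔ : ∀ {u v x y} → Rep G W u x → Rep G W v y →
                     maxDiff x y ≤ 1 ⇔ (∀ i → DistClose (W i) u v)
    Rep-maxDiff≤1⇔ {x = x} {y} rx ry = mk⇔
      (λ h i {_} {_} du dv → subst (_≤ 1) (coordinate du dv) (to (maxDiff≤⇔ x y) h i))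
      (λ h → from (maxDiff≤⇔ x y) λ i →
        let (_ , du , _) = rx i; (_ , dv , _) = ry i in
        subst (_≤ 1) (≡.sym (coordinate du dv)) (h i du dv))
      where
      coordinate : ∀ {i k k′} → Dist G _ (W i) k → Dist G _ (W i) k′ →
                   ℤ.∣ lookup y i ℤ.- lookup x i ∣ ≡ ∣ k - k′ ∣
      coordinate {i} {k} {k′} du dv = begin
        ℤ.∣ lookup y i ℤ.- lookup x i ∣  ≡⟨ cong₂ (λ a b → ℤ.∣ b ℤ.- a ∣)
                                              (Rep-lookup {x = x} rx du) (Rep-lookup {x = y} ry dv) ⟩
        ℤ.∣ + k′ ℤ.- + k ∣                ≡⟨ ∣[+m]-[+n]∣≡∣m-n∣ k′ k ⟩
        ∣ k′ - k ∣                        ≡⟨ ∣-∣-comm k′ k ⟩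
        ∣ k - k′ ∣                        ∎
        where open ≡-Reasoning

module Distance {G : Graph} (connected : Connected G) where

  dist : Fin (order G) → Fin (order G) → ℕ
  dist u w = proj₁ (walk⇒Dist G (proj₂ (connected u w)))

  dist-Dist : ∀ u w → Dist G u w (dist u w)
  dist-Dist u w = proj₂ (walk⇒Dist G (proj₂ (connected u w)))

  rep : ∀ {n} → (Fin n → Fin (order G)) → Fin (order G) → Vec ℤ n
  rep W u = tabulate (λ i → + dist u (W i))

  rep-Rep : ∀ {n} (W : Fin n → Fin (order G)) u → Rep G W u (rep W u)
  rep-Rep W u i = dist u (W i) , dist-Dist u (W i) , lookup∘tabulate _ i

module _ (G : Graph) {u v : Fin (order G)} (u≢v : u ≢ v) where

  Joins : Fin (order G) → Fin (order G) → Set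
  Joins a b = (a ≡ u × b ≡ v) ⊎ (a ≡ v × b ≡ u)

  joins? : ∀ a b → Dec (Joins a b)
  joins? a b = (a ≟ u ×-dec b ≟ v) ⊎-dec (a ≟ v ×-dec b ≟ u)

  Joins-swap : ∀ {a b} → Joins a b → Joins b a
  Joins-swap (inj₁ (a≡u , b≡v)) = inj₂ (b≡v , a≡u)
  Joins-swap (inj₂ (a≡v , b≡u)) = inj₁ (b≡u , a≡v)

  ¬Joins-loop : ∀ {a} → Joins a a → ⊥
  ¬Joins-loop (inj₁ (a≡u , a≡v)) = u≢v (trans (≡.sym a≡u) a≡v)
  ¬Joins-loop (inj₂ (a≡v , a≡u)) = u≢v (trans (≡.sym a≡u) a≡v)

  addEdge : Graph
  addEdge = record
    { order  = order G
    ; adj    = λ a b → adj G a b ∨ does (joins? a b)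
    ; sym    = λ a b → cong₂ _∨_ (sym G a b) (does-⇔ (mk⇔ Joins-swap Joins-swap) (joins? a b) (joins? b a))
    ; irrefl = λ a → cong₂ _∨_ (irrefl G a) (dec-false (joins? a a) ¬Joins-loop)
    }

  adj⇒adj-addEdge : ∀ {a b} → adj G a b ≡ true → adj addEdge a b ≡ true
  adj⇒adj-addEdge e = cong (_∨ _) e

  adj-addEdge-new : adj addEdge u v ≡ true
  adj-addEdge-new = trans (cong (adj G u v ∨_) (dec-true (joins? u v) (inj₁ (refl , refl))))
                          (∨-zeroʳ (adj G u v))

  adj-addEdge⇒ : ∀ {a b} → adj addEdge a b ≡ true → adj G a b ≡ true ⊎ Joins a b
  adj-addEdge⇒ {a} {b} e with adj G a b
  ... | true  = inj₁ refl
  ... | false = inj₂ (does-true (joins? a b) e)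
    where
    does-true : ∀ {A : Set} (A? : Dec A) → does A? ≡ true → A
    does-true (yes x) _  = x
    does-true (no _)  ()

  Walk⇒Walk-addEdge : ∀ {a b k} → Walk G a b k → Walk addEdge a b k
  Walk⇒Walk-addEdge here          = here
  Walk⇒Walk-addEdge (step e walk) = step (adj⇒adj-addEdge e) (Walk⇒Walk-addEdge walk)

module _ {G : Graph} (connected : Connected G) {u v : Fin (order G)} (u≢v : u ≢ v) where
  open Distance connected

  module _ {w} (close : DistClose G w u v) where

    dist-Lipschitz-addEdge : Lipschitz (addEdge G u≢v) (λ a → dist a w)
    dist-Lipschitz-addEdge e with adj-addEdge⇒ G u≢v e
    ... | inj₁ e′                 = adj⇒DistClose G w e′ (dist-Dist _ w) (dist-Dist _ w)
    ... | inj₂ (inj₁ (refl , refl)) = close (dist-Dist u w) (dist-Dist v w)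
    ... | inj₂ (inj₂ (refl , refl)) = subst (_≤ 1) (∣-∣-comm (dist u w) (dist v w))
                                         (close (dist-Dist u w) (dist-Dist v w))

    Dist⇔Dist-addEdge : ∀ {a k} → Dist G a w k ⇔ Dist (addEdge G u≢v) a w k
    Dist⇔Dist-addEdge {a} = mk⇔ lift (λ d⁺ → subst (Dist G a w)
      (Dist-unique (addEdge G u≢v) (lift (dist-Dist a w)) d⁺) (dist-Dist a w))
      where
      lift : ∀ {k} → Dist G a w k → Dist (addEdge G u≢v) a w k
      lift {k} d@(walk , _) = Walk⇒Walk-addEdge G u≢v walk , λ j walk⁺ → begin
        k             ≡⟨ Dist-unique G d (dist-Dist a w) ⟩
        dist a w      ≤⟨ Lipschitz⇒≤+length (addEdge G u≢v) dist-Lipschitz-addEdge walk⁺ ⟩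
        dist w w + j  ≡⟨ cong (_+ j) (Dist-unique G (dist-Dist w w) (Dist-refl G)) ⟩
        j             ∎
        where open ≤-Reasoning

module _ {n} {S : Vec ℤ n → Set} where

  module _ {G : Graph} {W : Fin n → Fin (order G)} (p : IsRealization S G W) where

    resolving : Resolving G W
    resolving = proj₁ (proj₂ (proj₂ p))

    S⇔Rep : ∀ x → S x ⇔ (∃[ u ] Rep G W u x)
    S⇔Rep = proj₂ (proj₂ (proj₂ p))

    Rep⇒EdgeStar⇔adj : ∀ {u v x y} → Rep G W u x → Rep G W v y → EdgeStar G W x y ⇔ adj G u v ≡ true
    Rep⇒EdgeStar⇔adj {u} {v} {x} {y} rx ry = mk⇔
      (λ (u′ , v′ , rx′ , ry′ , e) → subst₂ (λ a b → adj G a b ≡ true)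
        (resolving u′ u x rx′ rx) (resolving v′ v y ry′ ry) e)
      (λ e → u , v , rx , ry , e)

    EdgeStar⇒EdgeCanonical : ∀ {x y} → EdgeStar G W x y → EdgeCanonical S x y
    EdgeStar⇒EdgeCanonical {x} {y} (u , v , rx , ry , e) =
      from (S⇔Rep x) (u , rx) , from (S⇔Rep y) (v , ry) , ≤-antisym maxDiff≤1 (n≢0⇒n>0 maxDiff≢0)
      where
      maxDiff≤1 : maxDiff x y ≤ 1
      maxDiff≤1 = from (Rep-maxDiff≤1⇔ G {x = x} {y} rx ry) (λ i → adj⇒DistClose G (W i) e)
      maxDiff≢0 : maxDiff x y ≢ 0
      maxDiff≢0 h with to (maxDiff≡0⇔≡ {x = x} {y}) h
      ... | refl with resolving u v x rx ry
      ... | refl with () ← trans (≡.sym e) (irrefl G u)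

  module _ {G G′ : Graph} {W : Fin n → Fin (order G)} {W′ : Fin n → Fin (order G′)}
           (p : IsRealization S G W) (p′ : IsRealization S G′ W′) where
    open Distance (proj₁ p)

    transport : Fin (order G) → Fin (order G′)
    transport u = proj₁ (to (S⇔Rep p′ (rep W u)) (from (S⇔Rep p (rep W u)) (u , rep-Rep W u)))

    transport-Rep : ∀ u x → Rep G W u x → Rep G′ W′ (transport u) x
    transport-Rep u x r = subst (Rep G′ W′ (transport u)) (Rep-unique G {x = rep W u} {x} (rep-Rep W u) r)
      (proj₂ (to (S⇔Rep p′ (rep W u)) (from (S⇔Rep p (rep W u)) (u , rep-Rep W u))))

  transport-inverse : ∀ {G G′ : Graph} {W : Fin n → Fin (order G)} {W′ : Fin n → Fin (order G′)}
                      (p : IsRealization S G W) (p′ : IsRealization S G′ W′) u →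
                      transport p′ p (transport p p′ u) ≡ u
  transport-inverse {W = W} p p′ u = resolving p _ u (rep W u)
    (transport-Rep p′ p _ (rep W u) (transport-Rep p p′ u (rep W u) (rep-Rep W u))) (rep-Rep W u)
    where open Distance (proj₁ p)

  EdgeStar⇔⇒Equivalent : ∀ {G G′ : Graph} {W : Fin n → Fin (order G)} {W′ : Fin n → Fin (order G′)}
                         (p : IsRealization S G W) (p′ : IsRealization S G′ W′) →
                         (∀ x y → EdgeStar G W x y ⇔ EdgeStar G′ W′ x y) →
                         Equivalent {S = S} (G , W , p) (G′ , W′ , p′)
  EdgeStar⇔⇒Equivalent {G′ = G′} {W} {W′} p p′ same =
    transport p p′ ,
    transport-Rep p p′ ,
    inverseᵇ⇒bijective (strictlyInverseˡ⇒inverseˡ (transport p p′) (transport-inverse p′ p) ,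
                        strictlyInverseʳ⇒inverseʳ (transport p p′) (transport-inverse p p′)) ,
    λ u v → ⇔→≡ (Rep⇒EdgeStar⇔adj p′ {x = rep W u} {rep W v} (f-Rep u) (f-Rep v) ⇔-∘
                 (same (rep W u) (rep W v) ⇔-∘
                  ⇔-sym (Rep⇒EdgeStar⇔adj p {x = rep W u} {rep W v} (rep-Rep W u) (rep-Rep W v))))
    where
    open Distance (proj₁ p)
    f-Rep : ∀ u → Rep G′ W′ (transport p p′ u) (rep W u)
    f-Rep u = transport-Rep p p′ u (rep W u) (rep-Rep W u)

  module _ {G : Graph} {W : Fin n → Fin (order G)} (p : IsRealization S G W)
           {u v : Fin (order G)} (u≢v : u ≢ v) (close : ∀ i → DistClose G (W i) u v) where
    open Distance (proj₁ p)

    Rep⇔Rep-addEdge : ∀ {a} x → Rep G W a x ⇔ Rep (addEdge G u≢v) W a x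
    Rep⇔Rep-addEdge x = mk⇔
      (λ r i → map₂ (map₁ (to   (Dist⇔Dist-addEdge (proj₁ p) u≢v (close i)))) (r i))
      (λ r i → map₂ (map₁ (from (Dist⇔Dist-addEdge (proj₁ p) u≢v (close i)))) (r i))

    addEdge-realization : IsRealization S (addEdge G u≢v) W
    addEdge-realization =
      (λ a b → map₂ (Walk⇒Walk-addEdge G u≢v) (proj₁ p a b)) ,
      proj₁ (proj₂ p) ,
      (λ a b x ra rb → resolving p a b x (from (Rep⇔Rep-addEdge x) ra) (from (Rep⇔Rep-addEdge x) rb)) ,
      λ x → mk⇔ (map₂ (to (Rep⇔Rep-addEdge x))) (map₂ (from (Rep⇔Rep-addEdge x))) ⇔-∘ S⇔Rep p x

    UniquelyRealizable⇒adj : UniquelyRealizable S → adj G u v ≡ true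
    UniquelyRealizable⇒adj unique with unique (G , W , p) (addEdge G u≢v , W , addEdge-realization)
    ... | f , f-Rep , _ , f-adj = begin
      adj G u v                        ≡⟨ f-adj u v ⟩
      adj (addEdge G u≢v) (f u) (f v)  ≡⟨ cong₂ (adj (addEdge G u≢v)) (fixed u) (fixed v) ⟩
      adj (addEdge G u≢v) u v          ≡⟨ adj-addEdge-new G u≢v ⟩
      true                             ∎
      where
      open ≡-Reasoning
      fixed : ∀ a → f a ≡ a
      fixed a = resolving addEdge-realization (f a) a (rep W a)
        (f-Rep a (rep W a) (rep-Rep W a)) (to (Rep⇔Rep-addEdge (rep W a)) (rep-Rep W a))

  UniquelyRealizable⇒SameEdges : UniquelyRealizable S → (R : Realization S) → SameEdges R
  UniquelyRealizable⇒SameEdges unique (G , W , p) x y = mk⇔ (EdgeStar⇒EdgeCanonical p) canonical⇒star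
    where
    canonical⇒star : EdgeCanonical S x y → EdgeStar G W x y
    canonical⇒star (Sx , Sy , maxDiff≡1) with to (S⇔Rep p x) Sx | to (S⇔Rep p y) Sy
    ... | u , rx | v , ry = u , v , rx , ry , UniquelyRealizable⇒adj p u≢v close unique
      where
      close : ∀ i → DistClose G (W i) u v
      close = to (Rep-maxDiff≤1⇔ G {x = x} {y} rx ry) (≤-reflexive maxDiff≡1)
      u≢v : u ≢ v
      u≢v refl = 1+n≢0 (trans (≡.sym maxDiff≡1) (from maxDiff≡0⇔≡ (Rep-unique G {x = x} {y} rx ry)))

  SameEdges⇒UniquelyRealizable : ((R : Realization S) → SameEdges R) → UniquelyRealizable S
  SameEdges⇒UniquelyRealizable same R@(_ , _ , p) R′@(_ , _ , p′) =
    EdgeStar⇔⇒Equivalent p p′ λ x y → ⇔-sym (same R′ x y) ⇔-∘ same R x y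

corollary8 : (n : ℕ) (S : Vec ℤ n → Set) → Realizable S →
    (UniquelyRealizable S ⇔ ((R : Realization S) → SameEdges R))
corollary8 n S _ = mk⇔ UniquelyRealizable⇒SameEdges SameEdges⇒UniquelyRealizable
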